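{- If the matroid $N$ is obtained from the matroid $M$ by relaxing a circuit-hyperplane, then $\kappa(M)=\kappa(N)+1$.
   Context: Relaxing a circuit-hyperplane $H$ of $M$ (a set that is both a circuit and a hyperplane) means forming the matroid $N$ on $E(M)$ whose bases are the bases of $M$ together with $H$. A non-basis of a matroid is a set of size equal to the rank that is not a basis. A flat $F$ covers $X$ if $|X\cap F|>r(F)$. A flat cover is a set of flats covering every non-basis; $\kappa(M)$ is the minimum size of a flat cover of $M$. -}

module Defs where

open import Data.Nat using (ℕ; suc; _+_; _≤_; _<_)
open import Data.Fin using (Fin)
open import Data.Fin.Subset using (Subset; _⊆_; _⊂_; _∪_; _∩_; ∣_∣; ⁅_⁆; ⊤; _∈_; _∉_)
open import Data.List using (List; length)
open import Data.List.Relation.Unary.All using (All)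
open import Data.List.Relation.Unary.Any using (Any)
open import Data.Product using (_×_; Σ)
open import Data.Sum using (_⊎_)
open import Relation.Binary.PropositionalEquality using (_≡_)
open import Relation.Nullary using (¬_)

record Matroid (n : ℕ) : Set where
  field
    r          : Subset n → ℕ
    r-bounded  : ∀ X → r X ≤ ∣ X ∣
    r-mono     : ∀ {X Y} → X ⊆ Y → r X ≤ r Y
    r-submod   : ∀ X Y → r (X ∪ Y) + r (X ∩ Y) ≤ r X + r Y

module _ {n : ℕ} (M : Matroid n) where
  open Matroid M

  Independent : Subset n → Set
  Independent X = r X ≡ ∣ X ∣

  Dependent : Subset n → Set
  Dependent X = ¬ Independent X

  IsBasis : Subset n → Set
  IsBasis B = Independent B × ∣ B ∣ ≡ r ⊤

  IsNonBasis : Subset n → Set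
  IsNonBasis X = ∣ X ∣ ≡ r ⊤ × ¬ IsBasis X

  IsCircuit : Subset n → Set
  IsCircuit C = Dependent C × (∀ Y → Y ⊂ C → Independent Y)

  IsFlat : Subset n → Set
  IsFlat F = ∀ e → e ∉ F → r F < r (F ∪ ⁅ e ⁆)

  IsHyperplane : Subset n → Set
  IsHyperplane H = IsFlat H × suc (r H) ≡ r ⊤

  IsCircuitHyperplane : Subset n → Set
  IsCircuitHyperplane H = IsCircuit H × IsHyperplane H

  Covers : Subset n → Subset n → Set
  Covers F X = r F < ∣ X ∩ F ∣

  IsFlatCover : List (Subset n) → Set
  IsFlatCover Fs = All IsFlat Fs × (∀ X → IsNonBasis X → Any (λ F → Covers F X) Fs)

  IsKappa : ℕ → Set
  IsKappa k = Σ (List (Subset n)) (λ Fs → IsFlatCover Fs × length Fs ≡ k)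
            × (∀ Fs → IsFlatCover Fs → k ≤ length Fs)

IsRelaxation : {n : ℕ} → Matroid n → Matroid n → Subset n → Set
IsRelaxation {n} M N H =
  IsCircuitHyperplane M H × (∀ B → (IsBasis N B → IsBasis M B ⊎ B ≡ H) × (IsBasis M B ⊎ B ≡ H → IsBasis N B))

-- Relaxing H raises the rank of H by one and leaves every other rank
-- unchanged, and H is the only non-basis of M that becomes a basis of N.  So
-- closing in M the flats of a flat cover of N and adding the flat H gives a
-- flat cover of M.  Conversely, a set F covering the circuit H contains it; if
-- F also covers a set X of size r(E), then r(F) ≤ r(H), so F = H because H is
-- a flat, and then X = H.  Hence dropping from a flat cover of M the flats
-- covering H and closing the others in N gives a flat cover of N with at least
-- one flat fewer.  Minimum covers exist since covers of a given length can be
-- searched exhaustively.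
module Submission where

open import Defs
open import Data.Nat using (ℕ; zero; suc; _+_; _≤_; _<_; z≤n; s≤s; s≤s⁻¹; _≟_; _≤?_; _<?_)
open import Data.Nat.Properties
open import Data.Nat.Induction using (<-wellFounded)
open import Data.Fin using (Fin)
open import Data.Fin.Properties using (any?; all?)
open import Data.Fin.Subset renaming (⊥ to ∅)
open import Data.Fin.Subset.Properties
  using (_∈?_; anySubset?; nonempty?; Empty-unique; x∈p∪q⁻; x∈p∩q⁺; x∈⁅x⁆; x∈⁅y⁆⇒x≡y;
         x∈p∧x∉q⇒x∈p─q; x∈p⇒p-x⊂p; p⊆p∪q; q⊆p∪q; p∩q⊆p; p∩q⊆q; p─q⊆p; ∩-idem;
         ⊆-refl; ⊆-trans; ⊆-antisym; ⊆-min; ⊆⊤; ∣⊥∣≡0; ∣⁅x⁆∣≡1; ∣p∩q∣≤∣p∣; ∣p∩q∣≤∣q∣;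
         p⊆q⇒∣p∣≤∣q∣; p⊂q⇒∣p∣<∣q∣)
open import Data.Fin.Subset.Induction using (⊃-wellFounded)
open import Data.Vec using ([]; _∷_)
open import Data.Vec.Properties using (≡-dec)
import Data.Bool.Properties as Bool
open import Data.List using (List; []; _∷_; [_]; length; map; filter; _++_)
open import Data.List.Properties using (length-map; filter-notAll)
open import Data.List.Membership.Propositional using (lose) renaming (_∈_ to _∈ˡ_)
open import Data.List.Membership.Propositional.Properties using (∈-map⁺; ∈-++⁺ˡ; ∈-++⁺ʳ)
import Data.List.Relation.Unary.All as All
import Data.List.Relation.Unary.All.Properties as All
open import Data.List.Relation.Unary.Any as Any using (Any; here; there)
import Data.List.Relation.Unary.Any.Properties as Any
open import Data.Product using (Σ; ∃; _×_; _,_; proj₁; proj₂)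
open import Data.Sum using (_⊎_; inj₁; inj₂; [_,_]′)
open import Function using (_∘_)
open import Induction.WellFounded using (Acc; acc)
open import Relation.Binary.PropositionalEquality using (_≡_; _≢_; refl; sym; trans; cong; subst)
open import Relation.Nullary using (¬_; Dec; yes; no; contradiction)
open import Relation.Nullary.Decidable using (¬?; _×-dec_; _→-dec_; map′; decidable-stable)
open import Relation.Unary using (Decidable)

module _ {n : ℕ} where

  ∪-lub : {p q s : Subset n} → p ⊆ s → q ⊆ s → p ∪ q ⊆ s
  ∪-lub {p} {q} p⊆s q⊆s x∈p∪q with x∈p∪q⁻ p q x∈p∪q
  ... | inj₁ x∈p = p⊆s x∈p
  ... | inj₂ x∈q = q⊆s x∈q

  p∪⁅x⁆⊆q : {p q : Subset n} {x : Fin n} → p ⊆ q → x ∈ q → p ∪ ⁅ x ⁆ ⊆ q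
  p∪⁅x⁆⊆q {x = x} p⊆q x∈q = ∪-lub p⊆q λ y∈⁅x⁆ → subst (_∈ _) (sym (x∈⁅y⁆⇒x≡y x y∈⁅x⁆)) x∈q

  p⊂p∪⁅x⁆ : {p : Subset n} {x : Fin n} → x ∉ p → p ⊂ p ∪ ⁅ x ⁆
  p⊂p∪⁅x⁆ {p} {x} x∉p = p⊆p∪q ⁅ x ⁆ , x , q⊆p∪q p ⁅ x ⁆ (x∈⁅x⁆ x) , x∉p

  ∩-monoʳ-⊆ : (p : Subset n) {q s : Subset n} → q ⊆ s → p ∩ q ⊆ p ∩ s
  ∩-monoʳ-⊆ p {q} q⊆s x∈p∩q = x∈p∩q⁺ (p∩q⊆p p q x∈p∩q , q⊆s (p∩q⊆q p q x∈p∩q))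

  p⊆q∧∣q∣≤∣p∣⇒q⊆p : {p q : Subset n} → p ⊆ q → ∣ q ∣ ≤ ∣ p ∣ → q ⊆ p
  p⊆q∧∣q∣≤∣p∣⇒q⊆p {p} p⊆q ∣q∣≤∣p∣ {x} x∈q = decidable-stable (x ∈? p) λ x∉p →
    <⇒≱ (p⊂q⇒∣p∣<∣q∣ (p⊆q , x , x∈q , x∉p)) ∣q∣≤∣p∣

∣p∪q∣≤∣p∣+∣q∣ : ∀ {n} (p q : Subset n) → ∣ p ∪ q ∣ ≤ ∣ p ∣ + ∣ q ∣
∣p∪q∣≤∣p∣+∣q∣ []            []            = z≤n
∣p∪q∣≤∣p∣+∣q∣ (inside  ∷ p) (inside  ∷ q) = s≤s (≤-trans (∣p∪q∣≤∣p∣+∣q∣ p q) (+-monoʳ-≤ ∣ p ∣ (n≤1+n ∣ q ∣)))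
∣p∪q∣≤∣p∣+∣q∣ (inside  ∷ p) (outside ∷ q) = s≤s (∣p∪q∣≤∣p∣+∣q∣ p q)
∣p∪q∣≤∣p∣+∣q∣ (outside ∷ p) (inside  ∷ q) = subst (suc ∣ p ∪ q ∣ ≤_) (sym (+-suc ∣ p ∣ ∣ q ∣)) (s≤s (∣p∪q∣≤∣p∣+∣q∣ p q))
∣p∪q∣≤∣p∣+∣q∣ (outside ∷ p) (outside ∷ q) = ∣p∪q∣≤∣p∣+∣q∣ p q

∣p─q∣+∣p∩q∣≡∣p∣ : ∀ {n} (p q : Subset n) → ∣ p ─ q ∣ + ∣ p ∩ q ∣ ≡ ∣ p ∣
∣p─q∣+∣p∩q∣≡∣p∣ []            []            = refl
∣p─q∣+∣p∩q∣≡∣p∣ (inside  ∷ p) (inside  ∷ q) = trans (+-suc ∣ p ─ q ∣ ∣ p ∩ q ∣) (cong suc (∣p─q∣+∣p∩q∣≡∣p∣ p q))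
∣p─q∣+∣p∩q∣≡∣p∣ (inside  ∷ p) (outside ∷ q) = cong suc (∣p─q∣+∣p∩q∣≡∣p∣ p q)
∣p─q∣+∣p∩q∣≡∣p∣ (outside ∷ p) (inside  ∷ q) = ∣p─q∣+∣p∩q∣≡∣p∣ p q
∣p─q∣+∣p∩q∣≡∣p∣ (outside ∷ p) (outside ∷ q) = ∣p─q∣+∣p∩q∣≡∣p∣ p q

allSubsets : ∀ n → List (Subset n)
allSubsets zero    = [ [] ]
allSubsets (suc n) = map (inside ∷_) (allSubsets n) ++ map (outside ∷_) (allSubsets n)

∈-allSubsets : ∀ {n} (p : Subset n) → p ∈ˡ allSubsets n
∈-allSubsets []            = here refl
∈-allSubsets (inside  ∷ p) = ∈-++⁺ˡ (∈-map⁺ (inside ∷_) (∈-allSubsets p))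
∈-allSubsets (outside ∷ p) = ∈-++⁺ʳ _ (∈-map⁺ (outside ∷_) (∈-allSubsets p))

module _ {n : ℕ} where

  ∀-Subset? : {P : Subset n → Set} → Decidable P → Dec (∀ p → P p)
  ∀-Subset? P? with anySubset? (¬? ∘ P?)
  ... | yes (p , ¬Pp) = no λ all → ¬Pp (all p)
  ... | no  none      = yes λ p → decidable-stable (P? p) λ ¬Pp → none (p , ¬Pp)

  anyOfLength? : ∀ m {P : List (Subset n) → Set} → Decidable P → Dec (∃ λ xs → length xs ≡ m × P xs)
  anyOfLength? zero    P? = map′ (λ P[] → [] , refl , P[]) (λ { ([] , _ , P[]) → P[] }) (P? [])
  anyOfLength? (suc m) P? =
    map′ (λ { (x , xs , refl , P) → x ∷ xs , refl , P })
         (λ { (x ∷ xs , refl , P) → x , xs , refl , P })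
         (anySubset? λ x → anyOfLength? m (P? ∘ (x ∷_)))

module _ {P : ℕ → Set} (P? : Decidable P) where

  least : ∀ {m} → P m → ∃ λ k → P k × (∀ {j} → P j → k ≤ j)
  least = go (<-wellFounded _)
    where
    go : ∀ {m} → Acc _<_ m → P m → ∃ λ k → P k × (∀ {j} → P j → k ≤ j)
    go {m} (acc smaller) Pm with anyUpTo? P? m
    ... | yes (j , j<m , Pj) = go (smaller j<m) Pj
    ... | no  none           = m , Pm , λ Pj → ≮⇒≥ λ j<m → none (_ , j<m , Pj)

shortest : ∀ {n} {P : List (Subset n) → Set} → Decidable P → ∀ {xs} → P xs →
           ∃ λ ys → P ys × (∀ {zs} → P zs → length ys ≤ length zs)
shortest P? Pxs with least (λ m → anyOfLength? m P?) (_ , refl , Pxs)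
... | _ , (ys , refl , Pys) , minimal = ys , Pys , λ Pzs → minimal (_ , refl , Pzs)

module _ {n : ℕ} (Step : Subset n → Fin n → Set) (step? : ∀ A e → Dec (Step A e))
         (Inv : Subset n → Set) (preserve : ∀ {A e} → Inv A → Step A e → Inv (A ∪ ⁅ e ⁆)) where

  -- Opaque: letting the well-founded recursion unfold makes every later
  -- with-abstraction over a saturated set extremely slow.
  opaque
    saturate : ∀ {A} → Inv A → ∃ λ S → A ⊆ S × Inv S × (∀ e → e ∉ S → ¬ Step S e)
    saturate = go (⊃-wellFounded _)
      where
      go : ∀ {A} → Acc _⊃_ A → Inv A → ∃ λ S → A ⊆ S × Inv S × (∀ e → e ∉ S → ¬ Step S e)
      go {A} (acc larger) invA with any? (λ e → ¬? (e ∈? A) ×-dec step? A e)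
      ... | no  stuck            = A , ⊆-refl , invA , λ e e∉A step → stuck (e , e∉A , step)
      ... | yes (e , e∉A , step) with go (larger (p⊂p∪⁅x⁆ e∉A)) (preserve invA step)
      ...   | S , A∪e⊆S , invS , saturated = S , ⊆-trans (p⊆p∪q ⁅ e ⁆) A∪e⊆S , invS , saturated

module MatroidProperties {n : ℕ} (M : Matroid n) where
  open Matroid M public

  ∅-independent : Independent M ∅
  ∅-independent = trans (n≤0⇒n≡0 (≤-trans (r-bounded ∅) (≤-reflexive (∣⊥∣≡0 n)))) (sym (∣⊥∣≡0 n))

  independent-⊆ : ∀ {I B} → I ⊆ B → Independent M B → Independent M I
  independent-⊆ {I} {B} I⊆B indB = ≤-antisym (r-bounded I) (+-cancelˡ-≤ ∣ B ─ I ∣ ∣ I ∣ (r I) (begin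
      ∣ B ─ I ∣ + ∣ I ∣                 ≤⟨ +-monoʳ-≤ ∣ B ─ I ∣ (p⊆q⇒∣p∣≤∣q∣ I⊆B∩I) ⟩
      ∣ B ─ I ∣ + ∣ B ∩ I ∣             ≡⟨ ∣p─q∣+∣p∩q∣≡∣p∣ B I ⟩
      ∣ B ∣                             ≡⟨ indB ⟨
      r B                               ≤⟨ r-mono B⊆I∪B─I ⟩
      r (I ∪ (B ─ I))                   ≤⟨ m≤m+n _ _ ⟩
      r (I ∪ (B ─ I)) + r (I ∩ (B ─ I)) ≤⟨ r-submod I (B ─ I) ⟩
      r I + r (B ─ I)                   ≤⟨ +-monoʳ-≤ (r I) (r-bounded (B ─ I)) ⟩
      r I + ∣ B ─ I ∣                   ≡⟨ +-comm (r I) _ ⟩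
      ∣ B ─ I ∣ + r I                   ∎))
    where
    open ≤-Reasoning
    I⊆B∩I : I ⊆ B ∩ I
    I⊆B∩I x∈I = x∈p∩q⁺ (I⊆B x∈I , x∈I)
    B⊆I∪B─I : B ⊆ I ∪ (B ─ I)
    B⊆I∪B─I {x} x∈B with x ∈? I
    ... | yes x∈I = p⊆p∪q (B ─ I) x∈I
    ... | no  x∉I = q⊆p∪q I (B ─ I) (x∈p∧x∉q⇒x∈p─q x∈B x∉I)

  independent-∪⁅⁆ : ∀ {I e} → Independent M I → r I < r (I ∪ ⁅ e ⁆) → Independent M (I ∪ ⁅ e ⁆)
  independent-∪⁅⁆ {I} {e} indI rI<r = ≤-antisym (r-bounded (I ∪ ⁅ e ⁆)) (begin
      ∣ I ∪ ⁅ e ⁆ ∣     ≤⟨ ∣p∪q∣≤∣p∣+∣q∣ I ⁅ e ⁆ ⟩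
      ∣ I ∣ + ∣ ⁅ e ⁆ ∣ ≡⟨ cong (∣ I ∣ +_) (∣⁅x⁆∣≡1 e) ⟩
      ∣ I ∣ + 1         ≡⟨ +-comm ∣ I ∣ 1 ⟩
      suc ∣ I ∣         ≡⟨ cong suc indI ⟨
      suc (r I)         ≤⟨ rI<r ⟩
      r (I ∪ ⁅ e ⁆)     ∎)
    where open ≤-Reasoning

  circuit-⊆-dependent : ∀ {C X} → IsCircuit M C → X ⊆ C → Dependent M X → C ⊆ X
  circuit-⊆-dependent (_ , minimal) X⊆C depX {x} x∈C = decidable-stable (x ∈? _) λ x∉X →
    depX (minimal _ (X⊆C , x , x∈C , x∉X))

  circuit-rank : ∀ {C} → IsCircuit M C → suc (r C) ≡ ∣ C ∣
  circuit-rank {C} (depC , minimal) with nonempty? C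
  ... | no  empty    = contradiction (subst (Independent M) (sym (Empty-unique empty)) ∅-independent) depC
  ... | yes (e , e∈C) = ≤-antisym (≤∧≢⇒< (r-bounded C) depC) (begin
      ∣ C ∣                         ≡⟨ ∣p─q∣+∣p∩q∣≡∣p∣ C ⁅ e ⁆ ⟨
      ∣ C - e ∣ + ∣ C ∩ ⁅ e ⁆ ∣     ≤⟨ +-monoʳ-≤ ∣ C - e ∣ (≤-trans (∣p∩q∣≤∣q∣ C ⁅ e ⁆) (≤-reflexive (∣⁅x⁆∣≡1 e))) ⟩
      ∣ C - e ∣ + 1                 ≡⟨ +-comm ∣ C - e ∣ 1 ⟩
      suc ∣ C - e ∣                 ≡⟨ cong suc (minimal (C - e) (x∈p⇒p-x⊂p e∈C)) ⟨
      suc (r (C - e))               ≤⟨ s≤s (r-mono (p─q⊆p C ⁅ e ⁆)) ⟩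
      suc (r C)                     ∎)
    where open ≤-Reasoning

  _spans_ : Subset n → Fin n → Set
  A spans e = r (A ∪ ⁅ e ⁆) ≤ r A

  spans-mono : ∀ {J A e} → J ⊆ A → J spans e → A spans e
  spans-mono {J} {A} {e} J⊆A J-spans = +-cancelʳ-≤ (r J) (r (A ∪ ⁅ e ⁆)) (r A) (begin
      r (A ∪ ⁅ e ⁆) + r J                        ≤⟨ +-mono-≤ (r-mono A∪e⊆) (r-mono J⊆) ⟩
      r (A ∪ (J ∪ ⁅ e ⁆)) + r (A ∩ (J ∪ ⁅ e ⁆))  ≤⟨ r-submod A (J ∪ ⁅ e ⁆) ⟩
      r A + r (J ∪ ⁅ e ⁆)                        ≤⟨ +-monoʳ-≤ (r A) J-spans ⟩
      r A + r J                                  ∎)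
    where
    open ≤-Reasoning
    A∪e⊆ : A ∪ ⁅ e ⁆ ⊆ A ∪ (J ∪ ⁅ e ⁆)
    A∪e⊆ = ∪-lub (p⊆p∪q (J ∪ ⁅ e ⁆)) (⊆-trans (q⊆p∪q J ⁅ e ⁆) (q⊆p∪q A (J ∪ ⁅ e ⁆)))
    J⊆ : J ⊆ A ∩ (J ∪ ⁅ e ⁆)
    J⊆ x∈J = x∈p∩q⁺ (J⊆A x∈J , p⊆p∪q ⁅ e ⁆ x∈J)

  flat-⊆-maximal : ∀ {F G} → IsFlat M F → F ⊆ G → r G ≤ r F → G ⊆ F
  flat-⊆-maximal {F} flat F⊆G rG≤rF {x} x∈G = decidable-stable (x ∈? F) λ x∉F →
    <⇒≱ (flat x x∉F) (≤-trans (r-mono (p∪⁅x⁆⊆q F⊆G x∈G)) rG≤rF)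

  flat-closed : ∀ {F e} → IsFlat M F → F spans e → e ∈ F
  flat-closed {F} {e} flat F-spans = flat-⊆-maximal flat (p⊆p∪q ⁅ e ⁆) F-spans (q⊆p∪q F ⁅ e ⁆ (x∈⁅x⁆ e))

  closure : ∀ G → ∃ λ F → G ⊆ F × r F ≡ r G × IsFlat M F
  closure G
    with F , G⊆F , rF≤rG , saturated ← saturate _spans_ (λ A e → r (A ∪ ⁅ e ⁆) ≤? r A) (λ A → r A ≤ r G)
                                                (λ rA≤rG A-spans → ≤-trans A-spans rA≤rG) ≤-refl
    = F , G⊆F , ≤-antisym rF≤rG (r-mono G⊆F) , λ e e∉F → ≰⇒> (saturated e e∉F)

  cl : Subset n → Subset n
  cl G = proj₁ (closure G)

  ⊆-cl : ∀ G → G ⊆ cl G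
  ⊆-cl G = proj₁ (proj₂ (closure G))

  r-cl : ∀ G → r (cl G) ≡ r G
  r-cl G = proj₁ (proj₂ (proj₂ (closure G)))

  cl-flat : ∀ G → IsFlat M (cl G)
  cl-flat G = proj₂ (proj₂ (proj₂ (closure G)))

  cl-covers : ∀ {G} X → r G < ∣ X ∩ G ∣ → Covers M (cl G) X
  cl-covers {G} X rG< = begin-strict
      r (cl G)       ≡⟨ r-cl G ⟩
      r G            <⟨ rG< ⟩
      ∣ X ∩ G ∣      ≤⟨ p⊆q⇒∣p∣≤∣q∣ (∩-monoʳ-⊆ X (⊆-cl G)) ⟩
      ∣ X ∩ cl G ∣   ∎
    where open ≤-Reasoning

  spans-all⇒r≤ : ∀ {J Z} → (∀ {e} → e ∈ Z → J spans e) → r Z ≤ r J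
  spans-all⇒r≤ {J} {Z} spanned = ≤-trans (r-mono Z⊆clJ) (≤-reflexive (r-cl J))
    where
    Z⊆clJ : Z ⊆ cl J
    Z⊆clJ e∈Z = flat-closed (cl-flat J) (spans-mono (⊆-cl J) (spanned e∈Z))

  extend-independent : ∀ {I Z} → I ⊆ Z → Independent M I →
                       ∃ λ B → I ⊆ B × B ⊆ Z × Independent M B × r Z ≤ ∣ B ∣
  extend-independent {I} {Z} I⊆Z indI = finish (saturate Grows grows? Inv preserve (I⊆Z , indI))
    where
    Grows : Subset n → Fin n → Set
    Grows A e = e ∈ Z × r A < r (A ∪ ⁅ e ⁆)
    grows? : ∀ A e → Dec (Grows A e)
    grows? A e = (e ∈? Z) ×-dec (r A <? r (A ∪ ⁅ e ⁆))
    Inv : Subset n → Set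
    Inv A = A ⊆ Z × Independent M A
    preserve : ∀ {A e} → Inv A → Grows A e → Inv (A ∪ ⁅ e ⁆)
    preserve (A⊆Z , indA) (e∈Z , rA<) = p∪⁅x⁆⊆q A⊆Z e∈Z , independent-∪⁅⁆ indA rA<
    finish : (∃ λ B → I ⊆ B × Inv B × (∀ e → e ∉ B → ¬ Grows B e)) →
             ∃ λ B → I ⊆ B × B ⊆ Z × Independent M B × r Z ≤ ∣ B ∣
    finish (B , I⊆B , (B⊆Z , indB) , saturated) =
      B , I⊆B , B⊆Z , indB , ≤-trans (spans-all⇒r≤ spanned) (≤-reflexive indB)
      where
      spanned : ∀ {e} → e ∈ Z → B spans e
      spanned {e} e∈Z with e ∈? B
      ... | yes e∈B = r-mono (p∪⁅x⁆⊆q ⊆-refl e∈B)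
      ... | no  e∉B = ≮⇒≥ λ rB< → saturated e e∉B (e∈Z , rB<)

  basis-extension : ∀ {I} → Independent M I → ∃ λ B → I ⊆ B × IsBasis M B
  basis-extension indI with B , I⊆B , _ , indB , r⊤≤∣B∣ ← extend-independent ⊆⊤ indI =
    B , I⊆B , indB , ≤-antisym (≤-trans (≤-reflexive (sym indB)) (r-mono ⊆⊤)) r⊤≤∣B∣

  r≤-by-independent : ∀ {G k} → (∀ {I} → I ⊆ G → Independent M I → ∣ I ∣ ≤ k) → r G ≤ k
  r≤-by-independent {G} bound with I , _ , I⊆G , indI , rG≤∣I∣ ← extend-independent (⊆-min G) ∅-independent =
    ≤-trans rG≤∣I∣ (bound I⊆G indI)

  nonbasis-rank : ∀ {X} → IsNonBasis M X → r X < ∣ X ∣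
  nonbasis-rank {X} (size , notBasis) = ≤∧≢⇒< (r-bounded X) λ indX → notBasis (indX , size)

  isFlat? : Decidable (IsFlat M)
  isFlat? F = all? λ e → ¬? (e ∈? F) →-dec (r F <? r (F ∪ ⁅ e ⁆))

  isNonBasis? : Decidable (IsNonBasis M)
  isNonBasis? X = (∣ X ∣ ≟ r ⊤) ×-dec ¬? ((r X ≟ ∣ X ∣) ×-dec (∣ X ∣ ≟ r ⊤))

  isFlatCover? : Decidable (IsFlatCover M)
  isFlatCover? Fs = All.all? isFlat? Fs ×-dec
    ∀-Subset? λ X → isNonBasis? X →-dec Any.any? (λ F → r F <? ∣ X ∩ F ∣) Fs

  flatCover : IsFlatCover M (map cl (allSubsets n))
  flatCover = All.map⁺ (All.universal cl-flat (allSubsets n)) , λ X nb →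
    lose (∈-map⁺ cl (∈-allSubsets X))
         (cl-covers X (subst (r X <_) (cong ∣_∣ (sym (∩-idem X))) (nonbasis-rank nb)))

  κ-exists : ∃ λ k → IsKappa M k
  κ-exists with Fs , cover , minimal ← shortest isFlatCover? flatCover =
    length Fs , (Fs , cover , refl) , λ _ → minimal

module Relaxation {n : ℕ} (M N : Matroid n) (H : Subset n) (relaxation : IsRelaxation M N H) where
  module ℳ = MatroidProperties M
  module 𝒩 = MatroidProperties N

  private
    H-circuit : IsCircuit M H
    H-circuit = proj₁ (proj₁ relaxation)

    H-flat : IsFlat M H
    H-flat = proj₁ (proj₂ (proj₁ relaxation))

    r⊤≡1+rH : ℳ.r ⊤ ≡ suc (ℳ.r H)
    r⊤≡1+rH = sym (proj₂ (proj₂ (proj₁ relaxation)))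

    basisN⇒M⊎≡H : ∀ {B} → IsBasis N B → IsBasis M B ⊎ B ≡ H
    basisN⇒M⊎≡H {B} = proj₁ (proj₂ relaxation B)

    basisM⇒N : ∀ {B} → IsBasis M B → IsBasis N B
    basisM⇒N {B} = proj₂ (proj₂ relaxation B) ∘ inj₁

  ∣H∣≡r⊤ : ∣ H ∣ ≡ ℳ.r ⊤
  ∣H∣≡r⊤ = trans (sym (ℳ.circuit-rank H-circuit)) (sym r⊤≡1+rH)

  H-covers-H : Covers M H H
  H-covers-H = subst (ℳ.r H <_) (cong ∣_∣ (sym (∩-idem H))) (≤-reflexive (ℳ.circuit-rank H-circuit))

  H-nonbasisM : IsNonBasis M H
  H-nonbasisM = ∣H∣≡r⊤ , λ basis → proj₁ H-circuit (proj₁ basis)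

  H-basisN : IsBasis N H
  H-basisN = proj₂ (proj₂ relaxation H) (inj₂ refl)

  r⊤-relaxed : 𝒩.r ⊤ ≡ ℳ.r ⊤
  r⊤-relaxed with B , _ , basis ← ℳ.basis-extension ℳ.∅-independent =
    trans (sym (proj₂ (basisM⇒N basis))) (proj₂ basis)

  independentM⇒N : ∀ {I} → Independent M I → Independent N I
  independentM⇒N indI with B , I⊆B , basis ← ℳ.basis-extension indI =
    𝒩.independent-⊆ I⊆B (proj₁ (basisM⇒N basis))

  independentN⇒M⊎≡H : ∀ {I} → Independent N I → Independent M I ⊎ I ≡ H
  independentN⇒M⊎≡H {I} indI with B , I⊆B , basis ← 𝒩.basis-extension indI | basisN⇒M⊎≡H basis
  ... | inj₁ basisM = inj₁ (ℳ.independent-⊆ I⊆B (proj₁ basisM))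
  ... | inj₂ refl with ℳ.r I ≟ ∣ I ∣
  ...   | yes indMI = inj₁ indMI
  ...   | no  depMI = inj₂ (⊆-antisym I⊆B (ℳ.circuit-⊆-dependent H-circuit I⊆B depMI))

  rM≤rN : ∀ G → ℳ.r G ≤ 𝒩.r G
  rM≤rN G = ℳ.r≤-by-independent λ I⊆G indI →
    ≤-trans (≤-reflexive (sym (independentM⇒N indI))) (𝒩.r-mono I⊆G)

  rN≤rM : ∀ {G} → G ≢ H → 𝒩.r G ≤ ℳ.r G
  rN≤rM {G} G≢H = 𝒩.r≤-by-independent bound
    where
    bound : ∀ {I} → I ⊆ G → Independent N I → ∣ I ∣ ≤ ℳ.r G
    bound {I} I⊆G indI with independentN⇒M⊎≡H indI
    ... | inj₁ indMI = ≤-trans (≤-reflexive (sym indMI)) (ℳ.r-mono I⊆G)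
    ... | inj₂ refl with ℳ.r G ≤? ℳ.r H
    ...   | yes rG≤rH = contradiction (⊆-antisym (ℳ.flat-⊆-maximal H-flat I⊆G rG≤rH) I⊆G) G≢H
    ...   | no  rG≰rH = ≤-trans (≤-reflexive (trans ∣H∣≡r⊤ r⊤≡1+rH)) (≰⇒> rG≰rH)

  nonbasisN⇒M : ∀ {X} → IsNonBasis N X → IsNonBasis M X
  nonbasisN⇒M (size , notBasis) = trans size r⊤-relaxed , notBasis ∘ basisM⇒N

  nonbasisM⇒N : ∀ {X} → X ≢ H → IsNonBasis M X → IsNonBasis N X
  nonbasisM⇒N X≢H (size , notBasis) = trans size (sym r⊤-relaxed) , [ notBasis , X≢H ]′ ∘ basisN⇒M⊎≡H

  covers-H∧covers⇒≡H : ∀ {F X} → Covers M F H → Covers M F X → ∣ X ∣ ≡ ℳ.r ⊤ → X ≡ H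
  covers-H∧covers⇒≡H {F} {X} F-covers-H F-covers-X ∣X∣≡r⊤ = ⊆-antisym X⊆H H⊆X
    where
    open ≤-Reasoning
    H⊆F : H ⊆ F
    H⊆F = ⊆-trans (ℳ.circuit-⊆-dependent H-circuit (p∩q⊆p H F)
                    (<⇒≢ (≤-<-trans (ℳ.r-mono (p∩q⊆q H F)) F-covers-H)))
                  (p∩q⊆q H F)
    F⊆H : F ⊆ H
    F⊆H = ℳ.flat-⊆-maximal H-flat H⊆F (s≤s⁻¹ (begin
      suc (ℳ.r F)  ≤⟨ F-covers-X ⟩
      ∣ X ∩ F ∣    ≤⟨ ∣p∩q∣≤∣p∣ X F ⟩
      ∣ X ∣        ≡⟨ trans ∣X∣≡r⊤ r⊤≡1+rH ⟩
      suc (ℳ.r H)  ∎))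
    X⊆H : X ⊆ H
    X⊆H = ⊆-trans (p⊆q∧∣q∣≤∣p∣⇒q⊆p (p∩q⊆p X F) (begin
      ∣ X ∣        ≡⟨ trans ∣X∣≡r⊤ r⊤≡1+rH ⟩
      suc (ℳ.r H)  ≤⟨ s≤s (ℳ.r-mono H⊆F) ⟩
      suc (ℳ.r F)  ≤⟨ F-covers-X ⟩
      ∣ X ∩ F ∣    ∎)) (⊆-trans (p∩q⊆q X F) F⊆H)
    H⊆X : H ⊆ X
    H⊆X = p⊆q∧∣q∣≤∣p∣⇒q⊆p X⊆H (≤-reflexive (trans ∣H∣≡r⊤ (sym ∣X∣≡r⊤)))

  coversM⇒coversN-cl : ∀ {F X} → X ≢ H → ∣ X ∣ ≡ ℳ.r ⊤ → Covers M F X → Covers N (𝒩.cl F) X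
  coversM⇒coversN-cl {F} {X} X≢H ∣X∣≡r⊤ F-covers-X = 𝒩.cl-covers X (≤-<-trans (rN≤rM F≢H) F-covers-X)
    where
    F≢H : F ≢ H
    F≢H refl = X≢H (covers-H∧covers⇒≡H H-covers-H F-covers-X ∣X∣≡r⊤)

  flatCoverN⇒M : ∀ {Fs} → IsFlatCover N Fs → IsFlatCover M (H ∷ map ℳ.cl Fs)
  flatCoverN⇒M {Fs} (_ , coverN) = H-flat All.∷ All.map⁺ (All.universal ℳ.cl-flat Fs) , cover
    where
    cover : ∀ X → IsNonBasis M X → Any (λ F → Covers M F X) (H ∷ map ℳ.cl Fs)
    cover X nb with ≡-dec Bool._≟_ X H
    ... | yes refl = here H-covers-H
    ... | no  X≢H  = there (Any.map⁺ (Any.map (λ c → ℳ.cl-covers X (≤-<-trans (rM≤rN _) c))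
                                               (coverN X (nonbasisM⇒N X≢H nb))))

  flatCoverM⇒N : ∀ {Fs} → IsFlatCover M Fs → ∃ λ Gs → IsFlatCover N Gs × suc (length Gs) ≤ length Fs
  flatCoverM⇒N {Fs} (_ , coverM) =
    map 𝒩.cl kept , (All.map⁺ (All.universal 𝒩.cl-flat kept) , cover) , shorter
    where
    avoidsH? : Decidable (λ F → ¬ Covers M F H)
    avoidsH? F = ¬? (ℳ.r F <? ∣ H ∩ F ∣)
    kept : List (Subset n)
    kept = filter avoidsH? Fs
    shorter : suc (length (map 𝒩.cl kept)) ≤ length Fs
    shorter = subst (λ l → suc l ≤ length Fs) (sym (length-map 𝒩.cl kept))
                    (filter-notAll avoidsH? Fs (Any.map (λ c avoids → avoids c) (coverM H H-nonbasisM)))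
    cover : ∀ X → IsNonBasis N X → Any (λ F → Covers N F X) (map 𝒩.cl kept)
    cover X nb = transfer (coverM X (nonbasisN⇒M nb))
      where
      X≢H : X ≢ H
      X≢H refl = proj₂ nb H-basisN
      ∣X∣≡r⊤ : ∣ X ∣ ≡ ℳ.r ⊤
      ∣X∣≡r⊤ = proj₁ (nonbasisN⇒M nb)
      transfer : Any (λ F → Covers M F X) Fs → Any (λ F → Covers N F X) (map 𝒩.cl kept)
      transfer covered with Any.filter⁺ avoidsH? covered
      ... | inj₁ keptCovers = Any.map⁺ (Any.map (coversM⇒coversN-cl X≢H ∣X∣≡r⊤) keptCovers)
      ... | inj₂ coversH    = contradiction
        (covers-H∧covers⇒≡H (decidable-stable (_ <? _) coversH) (Any.lookup-result covered) ∣X∣≡r⊤) X≢H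

lemma3p13 : {n : ℕ} (M N : Matroid n) (H : Subset n) → IsRelaxation M N H →
    Σ ℕ (λ k → IsKappa N k × IsKappa M (suc k))
lemma3p13 M N H relaxation with _ , (Fs , coverN , refl) , minimalN ← MatroidProperties.κ-exists N =
  length Fs ,
  ((Fs , coverN , refl) , minimalN) ,
  ((H ∷ map ℳ.cl Fs , flatCoverN⇒M coverN , cong suc (length-map ℳ.cl Fs)) ,
   λ Gs coverM → let Gs′ , coverN′ , shorter = flatCoverM⇒N coverM
                 in ≤-trans (s≤s (minimalN Gs′ coverN′)) shorter)
  where open Relaxation M N H relaxation
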